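{- Let $M$ be a matroid and $\mathcal{C},\mathcal{C}^*$ a circuit signature and a cocircuit signature of $M$ such that the pair $\mathcal{C},\mathcal{C}^*$ has the 4-painting property (4P). Then both $\mathcal{C}$ and $\mathcal{C}^*$ have the strong circuit elimination property (CE).
   Context: Matroids are in the sense of Bruhn, Diestel, Kriesell, Pendavingh and Wollan (possibly infinite ground set) on $E$; cocircuits are circuits of the dual $M^*$. A signed subset $X$ of $E$ is a support $\underline{X}\subseteq E$ with a partition $(X^+,X^-)$; $-X$ swaps the parts; $\mathrm{sep}(X,Y)=(X^+\cap Y^-)\cup(X^-\cap Y^+)$. A circuit signature of $M$ is a set of signed subsets consisting of exactly two opposite signed subsets supported by each circuit; a cocircuit signature is a circuit signature of $M^*$. The pair $\mathcal{C},\mathcal{C}^*$ has (4P) if for every partition $E=B\,\dot\cup\,W\,\dot\cup\,G\,\dot\cup\,R$ and every $e\in B\cup W$ exactly one holds: there is $X\in\mathcal{C}$ with $e\in\underline{X}\subseteq B\cup W\cup G$, $\underline{X}\cap B\subseteq X^+$, $\underline{X}\cap W\subseteq X^-$; or there is $Y\in\mathcal{C}^*$ with $e\in\underline{Y}\subseteq B\cup W\cup R$, $\underline{Y}\cap B\subseteq Y^+$, $\underline{Y}\cap W\subseteq Y^-$. A set $\mathcal{D}$ of signed subsets has property (CE) if: whenever $C\in\mathcal{D}$, $X\subseteq\underline{C}$ and $(C_x\mid x\in X)$ is a family in $\mathcal{D}$ with $\underline{C_x}\cap X=\{x\}$ and $x\in\mathrm{sep}(C,C_x)$ for all $x\in X$,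 then for every $f\in\underline{C}\setminus\bigcup_{x\in X}\mathrm{sep}(C,C_x)$ there is $D\in\mathcal{D}$ with $f\in\underline{D}$, $D^+\subseteq(C^+\cup\bigcup_xC_x^+)\setminus X$ and $D^-\subseteq(C^-\cup\bigcup_xC_x^-)\setminus X$. -}

module Defs where

open import Level using (Level; _⊔_) renaming (suc to lsuc; zero to lzero)
open import Data.Product using (Σ; Σ-syntax; ∃; ∃-syntax; _×_; _,_)
open import Data.Sum using (_⊎_)
open import Data.Empty using (⊥)
open import Relation.Nullary using (¬_)
open import Relation.Binary.PropositionalEquality using (_≡_; _≢_)

Subset : Set → Set₁
Subset E = E → Set

module _ {E : Set} where

  ∅ : Subset E
  ∅ _ = ⊥

  _⊆_ : Subset E → Subset E → Set
  X ⊆ Y = ∀ e → X e → Y e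

  _≐_ : Subset E → Subset E → Set
  X ≐ Y = (X ⊆ Y) × (Y ⊆ X)

  _∪_ : Subset E → Subset E → Subset E
  (X ∪ Y) e = X e ⊎ Y e

  ｛_｝ : E → Subset E
  ｛ x ｝ e = e ≡ x

  IsMaximal : ∀ {ℓ} → (Subset E → Set ℓ) → Subset E → Set (lsuc lzero ⊔ ℓ)
  IsMaximal F J = F J × (∀ K → F K → J ⊆ K → K ⊆ J)

-- Matroids in the sense of Bruhn–Diestel–Kriesell–Pendavingh–Wollan
-- (independence axioms (I1),(I2),(I3),(IM)); E may be infinite.

record Matroid (E : Set) : Set₁ where
  field
    Ind      : Subset E → Set
    -- Ind is a set of subsets (membership respects equality of subsets)
    Ind-resp : ∀ {X Y} → X ≐ Y → Ind X → Ind Y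
    I1       : Ind ∅
    I2       : ∀ {X Y} → Ind Y → X ⊆ Y → Ind X
    I3       : ∀ {I I′} → Ind I → ¬ IsMaximal Ind I → IsMaximal Ind I′ →
               Σ[ x ∈ E ] (I′ x × ¬ I x × Ind (I ∪ ｛ x ｝))
    IM       : ∀ {I X} → Ind I → I ⊆ X →
               ∃[ J ] IsMaximal (λ K → Ind K × I ⊆ K × K ⊆ X) J

module _ {E : Set} where

  IsCircuitFor : ∀ {ℓ} → (Subset E → Set ℓ) → Subset E → Set (lsuc lzero ⊔ ℓ)
  IsCircuitFor P C = ¬ P C × (∀ D → D ⊆ C → ¬ P D → C ⊆ D)

  IsBase : Matroid E → Subset E → Set₁
  IsBase M B = IsMaximal (Matroid.Ind M) B

  IndDual : Matroid E → Subset E → Set₁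
  IndDual M X = Σ[ B ∈ Subset E ] (IsBase M B × (∀ e → X e → ¬ B e))

  IsCircuit : Matroid E → Subset E → Set₁
  IsCircuit M = IsCircuitFor (Matroid.Ind M)

  IsCocircuit : Matroid E → Subset E → Set₁
  IsCocircuit M = IsCircuitFor (IndDual M)

-- Signed subsets: each element is positive, negative, or outside the support

data Sign : Set where
  ⊕ ⊖ ⊙ : Sign

SignedSubset : Set → Set
SignedSubset E = E → Sign

module _ {E : Set} where

  supp : SignedSubset E → Subset E
  supp X e = (X e ≡ ⊕) ⊎ (X e ≡ ⊖)

  negS : Sign → Sign
  negS ⊕ = ⊖
  negS ⊖ = ⊕
  negS ⊙ = ⊙

  neg : SignedSubset E → SignedSubset E
  neg X e = negS (X e)

  _≗ˢ_ : SignedSubset E → SignedSubset E → Set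
  X ≗ˢ Y = ∀ e → X e ≡ Y e

  sep : SignedSubset E → SignedSubset E → Subset E
  sep X Y e = (X e ≡ ⊕ × Y e ≡ ⊖) ⊎ (X e ≡ ⊖ × Y e ≡ ⊕)

  record IsSignatureFor {ℓ} (P : Subset E → Set ℓ) (𝒞 : SignedSubset E → Set) : Set (lsuc lzero ⊔ ℓ) where
    field
      resp     : ∀ {X Y} → 𝒞 X → X ≗ˢ Y → 𝒞 Y
      sound    : ∀ {X} → 𝒞 X → IsCircuitFor P (supp X)
      complete : ∀ {C} → IsCircuitFor P C → Σ[ X ∈ SignedSubset E ] (𝒞 X × supp X ≐ C)
      negClosed : ∀ {X} → 𝒞 X → 𝒞 (neg X)
      twoOnly  : ∀ {X Y} → 𝒞 X → 𝒞 Y → supp X ≐ supp Y → (X ≗ˢ Y) ⊎ (X ≗ˢ neg Y)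

  CircuitSignature : Matroid E → (SignedSubset E → Set) → Set₁
  CircuitSignature M = IsSignatureFor (Matroid.Ind M)

  CocircuitSignature : Matroid E → (SignedSubset E → Set) → Set₁
  CocircuitSignature M = IsSignatureFor (IndDual M)

-- 4-painting property (4P). A partition E = B ∪ W ∪ G ∪ R is a colouring E → Colour.

data Colour : Set where
  black white green red : Colour

module _ {E : Set} where

  Painted : (E → Colour) → Colour → E → SignedSubset E → Set
  Painted c avoid e X =
    supp X e ×
    (∀ f → supp X f → c f ≢ avoid) ×
    (∀ f → supp X f → c f ≡ black → X f ≡ ⊕) ×
    (∀ f → supp X f → c f ≡ white → X f ≡ ⊖)

  FourPainting : (SignedSubset E → Set) → (SignedSubset E → Set) → Set
  FourPainting 𝒞 𝒞* =
    ∀ (c : E → Colour) (e : E) → (c e ≡ black ⊎ c e ≡ white) →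
      let A = Σ[ X ∈ SignedSubset E ] (𝒞 X × Painted c red e X)
          B = Σ[ Y ∈ SignedSubset E ] (𝒞* Y × Painted c green e Y)
      in (A ⊎ B) × ¬ (A × B)

-- Strong circuit elimination (CE). The family (C_x | x ∈ X) is given as a
-- dependent function on the elements of X.

  CE : (SignedSubset E → Set) → Set₁
  CE 𝒟 =
    ∀ (C : SignedSubset E) (X : Subset E) (Cx : (x : E) → X x → SignedSubset E) →
      𝒟 C → X ⊆ supp C →
      (∀ x (p : X x) → 𝒟 (Cx x p)) →
      (∀ x (p : X x) → supp (Cx x p) x × (∀ y → supp (Cx x p) y → X y → y ≡ x)) →
      (∀ x (p : X x) → sep C (Cx x p) x) →
      ∀ f → supp C f → ¬ (Σ[ x ∈ E ] Σ[ p ∈ X x ] sep C (Cx x p) f) →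
      Σ[ D ∈ SignedSubset E ]
        (𝒟 D × supp D f ×
         (∀ g → D g ≡ ⊕ → (C g ≡ ⊕ ⊎ (Σ[ x ∈ E ] Σ[ p ∈ X x ] Cx x p g ≡ ⊕)) × ¬ X g) ×
         (∀ g → D g ≡ ⊖ → (C g ≡ ⊖ ⊎ (Σ[ x ∈ E ] Σ[ p ∈ X x ] Cx x p g ≡ ⊖)) × ¬ X g))

-- Painting a pair X ∈ 𝒞, Y ∈ 𝒞* by the signs of X on the support of Y (red where only X
-- vanishes, green where Y vanishes) paints both X and Y unless they are separated somewhere;
-- so (4P) forces a signed circuit and cocircuit that agree at an element to disagree at another.
--
-- For (CE) paint the elements of X red, the others by the signs they carry in C and the C_x:
-- black if only positive, white if only negative, green if both, red if none; f is then black
-- or white. (4P) at f yields either the required D, or a cocircuit Y that agrees with C at f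
-- and that no C_x separates outside X; orthogonality to C produces some x ∈ X where Y agrees
-- with C_x, and orthogonality to C_x then gives a contradiction. Exchanging red and green
-- turns (4P) for 𝒞, 𝒞* into (4P) for 𝒞*, 𝒞, which gives (CE) for 𝒞*.
module Submission where

open import Defs
open import Level using (Level; 0ℓ)
open import Function using (_∘_)
open import Data.Product using (Σ-syntax; _×_; _,_; proj₁; proj₂; map₂)
open import Data.Sum using (_⊎_; inj₁; inj₂)
import Data.Sum as Sum
open import Data.Empty using (⊥-elim)
open import Relation.Nullary using (¬_; Dec; yes; no)
open import Relation.Binary.PropositionalEquality
  using (_≡_; _≢_; refl; sym; trans; cong; subst; module ≡-Reasoning)
open import Axiom.ExcludedMiddle using (ExcludedMiddle)

⊕≢⊖ : ⊕ ≢ ⊖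
⊕≢⊖ ()

module _ {E : Set} {X Y : SignedSubset E} {e : E} where

  sep⇒suppˡ : sep X Y e → supp X e
  sep⇒suppˡ (inj₁ (x⊕ , _)) = inj₁ x⊕
  sep⇒suppˡ (inj₂ (x⊖ , _)) = inj₂ x⊖

  sep⇒opposite : sep X Y e → Y e ≡ negS {E} (X e)
  sep⇒opposite (inj₁ (x⊕ , y⊖)) = trans y⊖ (cong (negS {E}) (sym x⊕))
  sep⇒opposite (inj₂ (x⊖ , y⊕)) = trans y⊕ (cong (negS {E}) (sym x⊖))

  agree⇒¬sep : X e ≡ Y e → ¬ sep X Y e
  agree⇒¬sep X≡Y (inj₁ (x⊕ , y⊖)) = ⊕≢⊖ (trans (sym x⊕) (trans X≡Y y⊖))
  agree⇒¬sep X≡Y (inj₂ (x⊖ , y⊕)) = ⊕≢⊖ (trans (sym y⊕) (trans (sym X≡Y) x⊖))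

  ¬sep⇒agree : supp X e → supp Y e → ¬ sep X Y e → X e ≡ Y e
  ¬sep⇒agree (inj₁ x⊕) (inj₁ y⊕) _ = trans x⊕ (sym y⊕)
  ¬sep⇒agree (inj₂ x⊖) (inj₂ y⊖) _ = trans x⊖ (sym y⊖)
  ¬sep⇒agree (inj₁ x⊕) (inj₂ y⊖) ¬sep = ⊥-elim (¬sep (inj₁ (x⊕ , y⊖)))
  ¬sep⇒agree (inj₂ x⊖) (inj₁ y⊕) ¬sep = ⊥-elim (¬sep (inj₂ (x⊖ , y⊕)))

orthColour : Sign → Sign → Colour
orthColour s ⊙ = green
orthColour ⊕ t = black
orthColour ⊖ t = white
orthColour ⊙ t = red

orthColour-¬red : ∀ {s t} → s ≡ ⊕ ⊎ s ≡ ⊖ → orthColour s t ≢ red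
orthColour-¬red {t = ⊕} (inj₁ refl) ()
orthColour-¬red {t = ⊖} (inj₁ refl) ()
orthColour-¬red {t = ⊙} (inj₁ refl) ()
orthColour-¬red {t = ⊕} (inj₂ refl) ()
orthColour-¬red {t = ⊖} (inj₂ refl) ()
orthColour-¬red {t = ⊙} (inj₂ refl) ()

orthColour-¬green : ∀ {s t} → t ≡ ⊕ ⊎ t ≡ ⊖ → orthColour s t ≢ green
orthColour-¬green {s = ⊕} (inj₁ refl) ()
orthColour-¬green {s = ⊖} (inj₁ refl) ()
orthColour-¬green {s = ⊙} (inj₁ refl) ()
orthColour-¬green {s = ⊕} (inj₂ refl) ()
orthColour-¬green {s = ⊖} (inj₂ refl) ()
orthColour-¬green {s = ⊙} (inj₂ refl) ()

orthColour-black : ∀ {s t} → orthColour s t ≡ black → s ≡ ⊕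
orthColour-black {s = ⊕} {t = ⊕} _ = refl
orthColour-black {s = ⊕} {t = ⊖} _ = refl
orthColour-black {s = ⊖} {t = ⊕} ()
orthColour-black {s = ⊖} {t = ⊖} ()
orthColour-black {s = ⊙} {t = ⊕} ()
orthColour-black {s = ⊙} {t = ⊖} ()
orthColour-black {t = ⊙} ()

orthColour-white : ∀ {s t} → orthColour s t ≡ white → s ≡ ⊖
orthColour-white {s = ⊖} {t = ⊕} _ = refl
orthColour-white {s = ⊖} {t = ⊖} _ = refl
orthColour-white {s = ⊕} {t = ⊕} ()
orthColour-white {s = ⊕} {t = ⊖} ()
orthColour-white {s = ⊙} {t = ⊕} ()
orthColour-white {s = ⊙} {t = ⊖} ()
orthColour-white {t = ⊙} ()

orthColour-diagonal : ∀ {s} → s ≡ ⊕ ⊎ s ≡ ⊖ → orthColour s s ≡ black ⊎ orthColour s s ≡ white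
orthColour-diagonal (inj₁ refl) = inj₁ refl
orthColour-diagonal (inj₂ refl) = inj₂ refl

module _ {E : Set} {P Q : SignedSubset E → Set} where

  fourPainting⇒orthogonal : FourPainting P Q → ∀ {X Y e} → P X → Q Y →
                            supp X e → X e ≡ Y e → ¬ (∀ g → ¬ sep X Y g)
  fourPainting⇒orthogonal fourP {X} {Y} {e} PX QY Xe X≡Y unseparated =
    proj₂ (fourP colour e e-colour) ((X , PX , X-painted) , (Y , QY , Y-painted))
    where
    colour : E → Colour
    colour g = orthColour (X g) (Y g)

    Ye : supp Y e
    Ye = subst (λ s → s ≡ ⊕ ⊎ s ≡ ⊖) X≡Y Xe

    e-colour : colour e ≡ black ⊎ colour e ≡ white
    e-colour = subst (λ t → orthColour (X e) t ≡ black ⊎ orthColour (X e) t ≡ white)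
                     X≡Y (orthColour-diagonal Xe)

    Y-agrees : ∀ g → supp X g → supp Y g → X g ≡ Y g
    Y-agrees g Xg Yg = ¬sep⇒agree {X = X} {Y} Xg Yg (unseparated g)

    X-painted : Painted colour red e X
    X-painted = Xe , (λ g Xg → orthColour-¬red Xg) ,
                (λ g _ → orthColour-black) , (λ g _ → orthColour-white)

    Y-painted : Painted colour green e Y
    Y-painted = Ye , (λ g Yg → orthColour-¬green Yg) ,
                (λ g Yg b → let x⊕ = orthColour-black b in trans (sym (Y-agrees g (inj₁ x⊕) Yg)) x⊕) ,
                (λ g Yg w → let x⊖ = orthColour-white w in trans (sym (Y-agrees g (inj₂ x⊖) Yg)) x⊖)

paint : {A B D : Set} → Dec A → Dec B → Dec D → Colour
paint (yes _) _       _       = red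
paint (no _)  (yes _) (yes _) = green
paint (no _)  (yes _) (no _)  = black
paint (no _)  (no _)  (yes _) = white
paint (no _)  (no _)  (no _)  = red

module _ {A B D : Set} where

  paint≢red⇒¬A : {a : Dec A} {b : Dec B} {d : Dec D} → paint a b d ≢ red → ¬ A
  paint≢red⇒¬A {yes _} ¬red = ⊥-elim (¬red refl)
  paint≢red⇒¬A {no ¬A} _    = ¬A

  paint≢red∧≢white⇒B : {a : Dec A} {b : Dec B} {d : Dec D} →
                       paint a b d ≢ red → paint a b d ≢ white → B
  paint≢red∧≢white⇒B {yes _}         ¬red _      = ⊥-elim (¬red refl)
  paint≢red∧≢white⇒B {no _} {yes B}  _    _      = B
  paint≢red∧≢white⇒B {no _} {no _} {yes _} _ ¬white = ⊥-elim (¬white refl)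
  paint≢red∧≢white⇒B {no _} {no _} {no _}  ¬red _   = ⊥-elim (¬red refl)

  paint≢red∧≢black⇒D : {a : Dec A} {b : Dec B} {d : Dec D} →
                       paint a b d ≢ red → paint a b d ≢ black → D
  paint≢red∧≢black⇒D {yes _}                 ¬red _      = ⊥-elim (¬red refl)
  paint≢red∧≢black⇒D {no _} {_}     {yes D}  _    _      = D
  paint≢red∧≢black⇒D {no _} {yes _} {no _}   _    ¬black = ⊥-elim (¬black refl)
  paint≢red∧≢black⇒D {no _} {no _}  {no _}   ¬red _      = ⊥-elim (¬red refl)

  paint≢green⇒black : {a : Dec A} {b : Dec B} {d : Dec D} →
                      ¬ A → B → paint a b d ≢ green → paint a b d ≡ black
  paint≢green⇒black {yes A}                  ¬A _ _      = ⊥-elim (¬A A)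
  paint≢green⇒black {no _} {yes _} {yes _}   _  _ ¬green = ⊥-elim (¬green refl)
  paint≢green⇒black {no _} {yes _} {no _}    _  _ _      = refl
  paint≢green⇒black {no _} {no ¬B}           _  B _      = ⊥-elim (¬B B)

  paint≢green⇒white : {a : Dec A} {b : Dec B} {d : Dec D} →
                      ¬ A → D → paint a b d ≢ green → paint a b d ≡ white
  paint≢green⇒white {yes A}                  ¬A _ _      = ⊥-elim (¬A A)
  paint≢green⇒white {no _} {yes _} {yes _}   _  _ ¬green = ⊥-elim (¬green refl)
  paint≢green⇒white {no _} {no _}  {yes _}   _  _ _      = refl
  paint≢green⇒white {no _} {_}     {no ¬D}   _  D _      = ⊥-elim (¬D D)

  paint-black : {a : Dec A} {b : Dec B} {d : Dec D} → ¬ A → B → ¬ D → paint a b d ≡ black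
  paint-black {yes A}                 ¬A _ _  = ⊥-elim (¬A A)
  paint-black {no _} {yes _} {no _}   _  _ _  = refl
  paint-black {no _} {_}     {yes D}  _  _ ¬D = ⊥-elim (¬D D)
  paint-black {no _} {no ¬B}          _  B _  = ⊥-elim (¬B B)

  paint-white : {a : Dec A} {b : Dec B} {d : Dec D} → ¬ A → ¬ B → D → paint a b d ≡ white
  paint-white {yes A}                 ¬A _  _ = ⊥-elim (¬A A)
  paint-white {no _} {no _}  {yes _}  _  _  _ = refl
  paint-white {no _} {yes B}          _  ¬B _ = ⊥-elim (¬B B)
  paint-white {no _} {no _}  {no ¬D}  _  _  D = ⊥-elim (¬D D)

module Elimination (em : ExcludedMiddle 0ℓ) {E : Set} {P Q : SignedSubset E → Set}
  (fourP : FourPainting P Q)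
  (C : SignedSubset E) (X : Subset E) (Cx : (x : E) → X x → SignedSubset E)
  (PC : P C) (PCx : ∀ x (p : X x) → P (Cx x p))
  (Cx-meets-X : ∀ x (p : X x) → supp (Cx x p) x × (∀ y → supp (Cx x p) y → X y → y ≡ x))
  (Cx-separates : ∀ x (p : X x) → sep C (Cx x p) x)
  (f : E) (Cf : supp C f) (f-unseparated : ¬ (Σ[ x ∈ E ] Σ[ p ∈ X x ] sep C (Cx x p) f))
  where

  Pos Neg : Subset E
  Pos g = C g ≡ ⊕ ⊎ Σ[ x ∈ E ] Σ[ p ∈ X x ] Cx x p g ≡ ⊕
  Neg g = C g ≡ ⊖ ⊎ Σ[ x ∈ E ] Σ[ p ∈ X x ] Cx x p g ≡ ⊖

  colour : E → Colour
  colour g = paint (em {X g}) (em {Pos g}) (em {Neg g})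

  f∉X : ¬ X f
  f∉X p = f-unseparated (f , p , Cx-separates f p)

  f-colour : supp C f → colour f ≡ black ⊎ colour f ≡ white
  f-colour (inj₁ c⊕) = inj₁ (paint-black f∉X (inj₁ c⊕) ¬Neg)
    where
    ¬Neg : ¬ Neg f
    ¬Neg (inj₁ c⊖)            = ⊕≢⊖ (trans (sym c⊕) c⊖)
    ¬Neg (inj₂ (x , p , cx⊖)) = f-unseparated (x , p , inj₁ (c⊕ , cx⊖))
  f-colour (inj₂ c⊖) = inj₂ (paint-white f∉X ¬Pos (inj₁ c⊖))
    where
    ¬Pos : ¬ Pos f
    ¬Pos (inj₁ c⊕)            = ⊕≢⊖ (trans (sym c⊕) c⊖)
    ¬Pos (inj₂ (x , p , cx⊕)) = f-unseparated (x , p , inj₂ (c⊖ , cx⊕))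

  Eliminant : SignedSubset E → Set
  Eliminant D = P D × supp D f ×
                (∀ g → D g ≡ ⊕ → Pos g × ¬ X g) × (∀ g → D g ≡ ⊖ → Neg g × ¬ X g)

  painted-circuit-eliminates : ∀ {D} → P D → Painted colour red f D → Eliminant D
  painted-circuit-eliminates {D} PD (Df , ¬red , black⇒⊕ , white⇒⊖) = PD , Df , positive , negative
    where
    positive : ∀ g → D g ≡ ⊕ → Pos g × ¬ X g
    positive g d⊕ = paint≢red∧≢white⇒B ¬red-g (λ w → ⊕≢⊖ (trans (sym d⊕) (white⇒⊖ g (inj₁ d⊕) w)))
                  , paint≢red⇒¬A ¬red-g
      where
      ¬red-g : colour g ≢ red
      ¬red-g = ¬red g (inj₁ d⊕)

    negative : ∀ g → D g ≡ ⊖ → Neg g × ¬ X g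
    negative g d⊖ = paint≢red∧≢black⇒D ¬red-g (λ b → ⊕≢⊖ (trans (sym (black⇒⊕ g (inj₂ d⊖) b)) d⊖))
                  , paint≢red⇒¬A ¬red-g
      where
      ¬red-g : colour g ≢ red
      ¬red-g = ¬red g (inj₂ d⊖)

  painted-cocircuit-impossible : ∀ {Y} → Q Y → ¬ Painted colour green f Y
  painted-cocircuit-impossible {Y} QY (Yf , ¬green , black⇒⊕ , white⇒⊖) =
    fourPainting⇒orthogonal fourP PC QY Cf C≡Y-at-f C-unseparated
    where
    Pos⇒≢⊖ : ∀ g → ¬ X g → Pos g → Y g ≢ ⊖
    Pos⇒≢⊖ g g∉X pos y⊖ =
      ⊕≢⊖ (trans (sym (black⇒⊕ g (inj₂ y⊖) (paint≢green⇒black g∉X pos (¬green g (inj₂ y⊖))))) y⊖)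

    Neg⇒≢⊕ : ∀ g → ¬ X g → Neg g → Y g ≢ ⊕
    Neg⇒≢⊕ g g∉X neg y⊕ =
      ⊕≢⊖ (trans (sym y⊕) (white⇒⊖ g (inj₁ y⊕) (paint≢green⇒white g∉X neg (¬green g (inj₁ y⊕)))))

    unseparated-outside-X : ∀ Z g → ¬ X g → (Z g ≡ ⊕ → Pos g) → (Z g ≡ ⊖ → Neg g) → ¬ sep Z Y g
    unseparated-outside-X _ g g∉X pos _   (inj₁ (z⊕ , y⊖)) = Pos⇒≢⊖ g g∉X (pos z⊕) y⊖
    unseparated-outside-X _ g g∉X _   neg (inj₂ (z⊖ , y⊕)) = Neg⇒≢⊕ g g∉X (neg z⊖) y⊕

    C≡Y-at-f : C f ≡ Y f
    C≡Y-at-f = ¬sep⇒agree {X = C} {Y} Cf Yf (unseparated-outside-X C f f∉X inj₁ inj₁)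

    Cx-unseparated : ∀ x (p : X x) → Cx x p x ≡ Y x → ∀ h → ¬ sep (Cx x p) Y h
    Cx-unseparated x p agree h sep-h with em {X h}
    ... | no h∉X =
      unseparated-outside-X (Cx x p) h h∉X (λ e → inj₂ (x , p , e)) (λ e → inj₂ (x , p , e)) sep-h
    ... | yes h∈X with proj₂ (Cx-meets-X x p) h (sep⇒suppˡ {X = Cx x p} {Y} sep-h) h∈X
    ...   | refl = agree⇒¬sep {X = Cx x p} {Y} agree sep-h

    C-unseparated : ∀ g → ¬ sep C Y g
    C-unseparated g sep-g with em {X g}
    ... | no g∉X = unseparated-outside-X C g g∉X inj₁ inj₁ sep-g
    ... | yes p  = fourPainting⇒orthogonal fourP (PCx g p) QY (proj₁ (Cx-meets-X g p)) Cx≡Y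
                     (Cx-unseparated g p Cx≡Y)
      where
      Cx≡Y : Cx g p g ≡ Y g
      Cx≡Y = trans (sep⇒opposite {X = C} {Cx g p} (Cx-separates g p))
                   (sym (sep⇒opposite {X = C} {Y} sep-g))

  eliminant : Σ[ D ∈ SignedSubset E ] Eliminant D
  eliminant with proj₁ (fourP colour f (f-colour Cf))
  ... | inj₁ (D , PD , painted) = D , painted-circuit-eliminates PD painted
  ... | inj₂ (Y , QY , painted) = ⊥-elim (painted-cocircuit-impossible QY painted)

fourPainting⇒CE : ∀ {E} {P Q : SignedSubset E → Set} →
                  ExcludedMiddle 0ℓ → FourPainting P Q → CE P
fourPainting⇒CE em fourP C X Cx PC _ PCx Cx-meets-X Cx-separates f Cf f-unseparated =
  Elimination.eliminant em fourP C X Cx PC PCx Cx-meets-X Cx-separates f Cf f-unseparated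

swapRedGreen : Colour → Colour
swapRedGreen red   = green
swapRedGreen green = red
swapRedGreen black = black
swapRedGreen white = white

swapRedGreen-involutive : ∀ c → swapRedGreen (swapRedGreen c) ≡ c
swapRedGreen-involutive red   = refl
swapRedGreen-involutive green = refl
swapRedGreen-involutive black = refl
swapRedGreen-involutive white = refl

swapRedGreen-injective : ∀ {c d} → swapRedGreen c ≡ swapRedGreen d → c ≡ d
swapRedGreen-injective {c} {d} eq = begin
  c                               ≡⟨ swapRedGreen-involutive c ⟨
  swapRedGreen (swapRedGreen c)   ≡⟨ cong swapRedGreen eq ⟩
  swapRedGreen (swapRedGreen d)   ≡⟨ swapRedGreen-involutive d ⟩
  d                               ∎
  where open ≡-Reasoning

module _ {E : Set} {c c′ : E → Colour} where

  painted-swapRedGreen : (∀ g → c′ g ≡ swapRedGreen (c g)) →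
                         ∀ {avoid e X} → Painted c avoid e X → Painted c′ (swapRedGreen avoid) e X
  painted-swapRedGreen c′≡ (Xe , ¬avoid , black⇒⊕ , white⇒⊖) =
    Xe ,
    (λ g Xg eq → ¬avoid g Xg (swapRedGreen-injective (trans (sym (c′≡ g)) eq))) ,
    (λ g Xg eq → black⇒⊕ g Xg (swapRedGreen-injective (trans (sym (c′≡ g)) eq))) ,
    (λ g Xg eq → white⇒⊖ g Xg (swapRedGreen-injective (trans (sym (c′≡ g)) eq)))

fourPainting-sym : ∀ {E} {P Q : SignedSubset E → Set} → FourPainting P Q → FourPainting Q P
fourPainting-sym fourP c e e-colour
  with choice , exclusive ←
         fourP (swapRedGreen ∘ c) e (Sum.map (cong swapRedGreen) (cong swapRedGreen) e-colour)
  = Sum.swap (Sum.map (map₂ (map₂ unswap)) (map₂ (map₂ unswap)) choice)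
  , λ (QY , PX) → exclusive (map₂ (map₂ swap) PX , map₂ (map₂ swap) QY)
  where
  swap : ∀ {avoid X} → Painted c avoid e X → Painted (swapRedGreen ∘ c) (swapRedGreen avoid) e X
  swap = painted-swapRedGreen (λ _ → refl)

  unswap : ∀ {avoid X} → Painted (swapRedGreen ∘ c) avoid e X → Painted c (swapRedGreen avoid) e X
  unswap = painted-swapRedGreen (λ g → sym (swapRedGreen-involutive (c g)))

lemma5p15 : (em : ∀ {ℓ : Level} → ExcludedMiddle ℓ) →
    {E : Set} (M : Matroid E) (𝒞 𝒞* : SignedSubset E → Set) →
    CircuitSignature M 𝒞 → CocircuitSignature M 𝒞* → FourPainting 𝒞 𝒞* →
    CE 𝒞 × CE 𝒞*
lemma5p15 em _ _ _ _ _ fourP = fourPainting⇒CE em fourP , fourPainting⇒CE em (fourPainting-sym fourP)
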